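{- Let $G$ be a finite commutative group and $x_1,\dots,x_I\in G$. A basis for the lattice of relations $\{(a_1,\dots,a_I)\in\mathbb{Z}^I:\sum_i a_ix_i=0\}$ between the $x_i$ can be computed at the expense of $3I\,\#G$ operations (or comparisons) in $G$. -}

module Defs where

open import Level using (Level)
open import Algebra.Bundles using (AbelianGroup)
open import Data.Nat as ℕ using (ℕ; zero; suc)
open import Data.Integer as ℤ using (ℤ; +_; -[1+_])
open import Data.Fin using (Fin)
import Data.Fin.Properties as FinP
open import Data.Vec using (Vec; []; _∷_; lookup; replicate; zipWith; map)
open import Data.Product using (Σ; ∃; _×_; _,_)
open import Relation.Binary.PropositionalEquality using (_≡_; refl; cong)
open import Relation.Nullary using (Dec; yes; no; ¬_)

record FiniteOfOrder {c ℓ} (G : AbelianGroup c ℓ) (n : ℕ) : Set (c Level.⊔ ℓ) where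
  open AbelianGroup G
  field
    to      : Carrier → Fin n
    from    : Fin n → Carrier
    to-cong : ∀ {x y} → x ≈ y → to x ≡ to y
    from-to : ∀ x → from (to x) ≈ x
    to-from : ∀ i → to (from i) ≡ i

module _ {c ℓ} (G : AbelianGroup c ℓ) {n : ℕ} (fin : FiniteOfOrder G n) where
  open AbelianGroup G
  open FiniteOfOrder fin

  decEq : (x y : Carrier) → Dec (x ≈ y)
  decEq x y with FinP._≟_ (to x) (to y)
  ... | yes p = yes (trans (sym (from-to x)) (trans (reflexive (cong from p)) (from-to y)))
  ... | no ¬p = no (λ x≈y → ¬p (to-cong x≈y))

module _ {c ℓ} (G : AbelianGroup c ℓ) where
  open AbelianGroup G

  nmul : ℕ → Carrier → Carrier
  nmul zero    x = ε
  nmul (suc k) x = x ∙ nmul k x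

  zmul : ℤ → Carrier → Carrier
  zmul (+ k)      x = nmul k x
  zmul -[1+ k ]   x = (nmul (suc k) x) ⁻¹

  lsum : ∀ {I} → Vec ℤ I → Vec Carrier I → Carrier
  lsum []       []       = ε
  lsum (a ∷ as) (x ∷ xs) = zmul a x ∙ lsum as xs

  IsRelation : ∀ {I} → Vec Carrier I → Vec ℤ I → Set ℓ
  IsRelation xs a = lsum a xs ≈ ε

comb : ∀ {I m} → Vec ℤ m → Vec (Vec ℤ I) m → Vec ℤ I
comb {I} []       []       = replicate I (+ 0)
comb     (c ∷ cs) (b ∷ bs) = zipWith ℤ._+_ (map (c ℤ.*_) b) (comb cs bs)

IsRelationBasis : ∀ {c ℓ} (G : AbelianGroup c ℓ) {I m : ℕ}
                  → Vec (AbelianGroup.Carrier G) I → Vec (Vec ℤ I) m → Set ℓ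
IsRelationBasis G {I} {m} xs bs =
    (∀ j → IsRelation G xs (lookup bs j))
  × (∀ a → IsRelation G xs a → ∃ λ (cs : Vec ℤ m) → comb cs bs ≡ a)
  × (∀ (cs : Vec ℤ m) → comb cs bs ≡ replicate I (+ 0) → cs ≡ replicate m (+ 0))

-- It holds k handles to group
-- elements; it may multiply two held elements, invert one, or compare two
-- held elements for equality (branching on the answer). All other
-- (integer) computation is free.

data Alg (I : ℕ) : ℕ → Set where
  done : ∀ {k m} → Vec (Vec ℤ I) m → Alg I k
  mul  : ∀ {k} → Fin k → Fin k → Alg I (suc k) → Alg I k
  inv  : ∀ {k} → Fin k → Alg I (suc k) → Alg I k
  cmp  : ∀ {k} → Fin k → Fin k → (ifEq ifNeq : Alg I k) → Alg I k

record Result (I : ℕ) : Set where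
  constructor result
  field
    {size}  : ℕ
    output  : Vec (Vec ℤ I) size
    cost    : ℕ

module _ {c ℓ} (G : AbelianGroup c ℓ) {n : ℕ} (fin : FiniteOfOrder G n) where
  open AbelianGroup G

  run : ∀ {I k} → Alg I k → Vec Carrier k → Result I
  run (done bs)    st = result bs 0
  run (mul a b t)  st with run t ((lookup st a ∙ lookup st b) ∷ st)
  ... | result o c' = result o (suc c')
  run (inv a t)    st with run t (lookup st a ⁻¹ ∷ st)
  ... | result o c' = result o (suc c')
  run (cmp a b t u) st with decEq G fin (lookup st a) (lookup st b)
  ... | yes _ with run t st
  ...   | result o c' = result o (suc c')
  run (cmp a b t u) st | no _ with run u st
  ...   | result o c' = result o (suc c')

{-# OPTIONS --safe #-}
-- Treat x₁, …, x_I one at a time, keeping a repetition-free list of the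
-- subgroup H spanned by the elements treated so far, each with a coefficient vector.
-- For the next element x, compare x, 2x, 3x, … with all of H until e x ∈ H, say e x = Σ cᵢ xᵢ.
-- Then e is the order of x modulo H, the cosets H + j x (j < e) list the new subgroup, and
-- (e, −c) extends any relation basis of the previous elements to one including x.
-- Level j costs #H comparisons, #H additions to list H + j x, and one addition for (j+1) x;
-- since the e cosets are distinct, e · #H ≤ #G, so a stage costs at most (#G / #H)(2 #H + 1) ≤ 3 #G.

module Submission where

open import Defs
open import Level using (_⊔_)
open import Algebra.Bundles using (AbelianGroup)
open import Data.Nat as ℕ using (ℕ; zero; suc; _<_; _≤_; _*_; s≤s; z≤n; NonZero)
import Data.Nat.Properties as ℕ
open import Data.Integer as ℤ using (ℤ; +_; -[1+_]; _⊖_)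
import Data.Integer.Properties as ℤ
open import Data.Integer.Tactic.RingSolver using (solve-∀)
open import Data.Vec using (Vec; []; _∷_; zipWith; map; replicate; lookup; tabulate)
import Data.Vec.Properties as Vec
open import Data.Integer.DivMod using (_/ℕ_; _%ℕ_; a≡a%ℕn+[a/ℕn]*n; n%ℕd<d)
open import Relation.Binary.PropositionalEquality as ≡ using (_≡_)
open import Data.Product using (Σ; ∃; ∃₂; _×_; _,_; proj₁; proj₂; uncurry)
open import Data.Sum using (inj₁; inj₂)
open import Data.Fin as Fin using (Fin; toℕ; remQuot; combine)
import Data.Fin.Properties as Fin
open import Data.Empty using (⊥-elim)
open import Relation.Nullary using (¬_; yes; no)
open import Function using (_∘_; id)
import Data.Vec.Functional as Vector
open import Data.Nat.DivMod using (_/_; m*n/n≡m; /-monoˡ-≤; m/n≤m; m/n*n≤m)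
open import Data.Nat.Tactic.RingSolver renaming (solve-∀ to ℕ-solve-∀)

[1+m/n]*n≰m : ∀ m n .{{_ : NonZero n}} → ¬ (suc (m / n) * n ≤ m)
[1+m/n]*n≰m m n [1+m/n]*n≤m =
  ℕ.1+n≰n (≡.subst (ℕ._≤ m / n) (m*n/n≡m (suc (m / n)) n) (/-monoˡ-≤ n [1+m/n]*n≤m))

m/n*[1+2n]≤3m : ∀ m n .{{_ : NonZero n}} → (m / n) * suc (2 * n) ≤ 3 * m
m/n*[1+2n]≤3m m n = begin
  (m / n) * suc (2 * n)          ≡⟨ expand (m / n) n ⟩
  m / n ℕ.+ 2 * ((m / n) * n)    ≤⟨ ℕ.+-mono-≤ (m/n≤m m n) (ℕ.*-monoʳ-≤ 2 (m/n*n≤m m n)) ⟩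
  m ℕ.+ 2 * m                      ≡⟨⟩
  3 * m                            ∎
  where
  open ℕ.≤-Reasoning
  expand : ∀ q n → q * suc (2 * n) ≡ q ℕ.+ 2 * (q * n)
  expand = ℕ-solve-∀

I*[3*n]≡3*I*n : ∀ I n → I * (3 * n) ≡ 3 * I * n
I*[3*n]≡3*I*n = ℕ-solve-∀

⊖-surjective : ∀ a → ∃₂ λ p q → a ≡ p ⊖ q
⊖-surjective (+ p)      = p , 0 , ≡.refl
⊖-surjective -[1+ q ]   = 0 , suc q , ≡.refl

⊖-+-⊖ : ∀ p q p′ q′ → (p ⊖ q) ℤ.+ (p′ ⊖ q′) ≡ (p ℕ.+ p′) ⊖ (q ℕ.+ q′)
⊖-+-⊖ p q p′ q′ = begin
  (p ⊖ q) ℤ.+ (p′ ⊖ q′)                    ≡⟨ ≡.cong₂ ℤ._+_ (ℤ.m-n≡m⊖n p q) (ℤ.m-n≡m⊖n p′ q′) ⟨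
  (+ p ℤ.- + q) ℤ.+ (+ p′ ℤ.- + q′)        ≡⟨ shuffle (+ p) (+ q) (+ p′) (+ q′) ⟩
  (+ p ℤ.+ + p′) ℤ.- (+ q ℤ.+ + q′)        ≡⟨ ≡.cong₂ ℤ._-_ (ℤ.pos-+ p p′) (ℤ.pos-+ q q′) ⟨
  + (p ℕ.+ p′) ℤ.- + (q ℕ.+ q′)            ≡⟨ ℤ.m-n≡m⊖n (p ℕ.+ p′) (q ℕ.+ q′) ⟩
  (p ℕ.+ p′) ⊖ (q ℕ.+ q′)                  ∎
  where
  open ≡.≡-Reasoning
  shuffle : ∀ a b c d → (a ℤ.- b) ℤ.+ (c ℤ.- d) ≡ (a ℤ.+ c) ℤ.- (b ℤ.+ d)
  shuffle = solve-∀

remQuot-injective : ∀ {K N} {i i′ : Fin (K * N)} → remQuot {K} N i ≡ remQuot {K} N i′ → i ≡ i′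
remQuot-injective {K} {N} {i} {i′} eq =
  ≡.trans (≡.sym (Fin.combine-remQuot {K} N i)) (≡.trans (≡.cong (uncurry combine) eq) (Fin.combine-remQuot {K} N i′))

infixl 6 _+ᵛ_
infixr 7 _*ᵛ_

_+ᵛ_ : ∀ {m} → Vec ℤ m → Vec ℤ m → Vec ℤ m
_+ᵛ_ = zipWith ℤ._+_

_*ᵛ_ : ∀ {m} → ℤ → Vec ℤ m → Vec ℤ m
q *ᵛ v = map (q ℤ.*_) v

-ᵛ_ : ∀ {m} → Vec ℤ m → Vec ℤ m
-ᵛ v = map ℤ.-_ v

comb-0∷ : ∀ {m s} (cs : Vec ℤ s) (B : Vec (Vec ℤ m) s) → comb cs (map (+ 0 ∷_) B) ≡ + 0 ∷ comb cs B
comb-0∷ []       []      = ≡.refl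
comb-0∷ (c ∷ cs) (b ∷ B) rewrite comb-0∷ cs B | ℤ.*-zeroʳ c = ≡.refl

*ᵛ-neg-cancel : ∀ {m} q (w u : Vec ℤ m) → q *ᵛ (-ᵛ w) +ᵛ (q *ᵛ w +ᵛ u) ≡ u
*ᵛ-neg-cancel q []      []      = ≡.refl
*ᵛ-neg-cancel q (a ∷ w) (b ∷ u) = ≡.cong₂ _∷_ (cancel q a b) (*ᵛ-neg-cancel q w u)
  where
  cancel : ∀ q a b → q ℤ.* ℤ.- a ℤ.+ (q ℤ.* a ℤ.+ b) ≡ b
  cancel = solve-∀

0*ᵛ-+ᵛ : ∀ {m} (v u : Vec ℤ m) → + 0 *ᵛ v +ᵛ u ≡ u
0*ᵛ-+ᵛ []      []      = ≡.refl
0*ᵛ-+ᵛ (a ∷ v) (b ∷ u) = ≡.cong₂ _∷_ (ℤ.+-identityˡ b) (0*ᵛ-+ᵛ v u)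

module Multiples {c ℓ} (G : AbelianGroup c ℓ) where
  open AbelianGroup G
  open import Algebra.Properties.AbelianGroup G
  open import Algebra.Properties.CommutativeMonoid.Mult commutativeMonoid renaming (_×_ to _·_)
  open import Algebra.Properties.CommutativeSemigroup commutativeSemigroup using (interchange)
  open import Relation.Binary.Reasoning.Setoid setoid

  nmul≡· : ∀ k x → nmul G k x ≡ k · x
  nmul≡· zero    x = ≡.refl
  nmul≡· (suc k) x = ≡.cong (x ∙_) (nmul≡· k x)

  private
    _⊖·_ : ℕ → ℕ → Carrier → Carrier
    (p ⊖· q) x = p · x ∙ (q · x) ⁻¹

    zmul-⊖ : ∀ p q x → zmul G (p ⊖ q) x ≈ (p ⊖· q) x
    zmul-⊖ zero    zero    x = sym (trans (∙-congˡ ε⁻¹≈ε) (identityˡ ε))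
    zmul-⊖ (suc p) zero    x = sym (trans (∙-congˡ ε⁻¹≈ε) (trans (identityʳ _) (reflexive (≡.sym (nmul≡· (suc p) x)))))
    zmul-⊖ zero    (suc q) x = trans (⁻¹-cong (reflexive (nmul≡· (suc q) x))) (sym (identityˡ _))
    zmul-⊖ (suc p) (suc q) x = begin
      zmul G (suc p ⊖ suc q) x     ≡⟨ ≡.cong (λ a → zmul G a x) (ℤ.[1+m]⊖[1+n]≡m⊖n p q) ⟩
      zmul G (p ⊖ q) x             ≈⟨ zmul-⊖ p q x ⟩
      p · x ∙ (q · x) ⁻¹           ≈⟨ xyx⁻¹≈y x _ ⟨
      x ∙ (p · x ∙ (q · x) ⁻¹) ∙ x ⁻¹ ≈⟨ ∙-congʳ (sym (assoc x _ _)) ⟩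
      (x ∙ p · x) ∙ (q · x) ⁻¹ ∙ x ⁻¹ ≈⟨ assoc _ _ _ ⟩
      (x ∙ p · x) ∙ ((q · x) ⁻¹ ∙ x ⁻¹) ≈⟨ ∙-congˡ (trans (⁻¹-∙-comm _ _) (⁻¹-cong (comm _ _))) ⟩
      (suc p ⊖· suc q) x ∎

    ⊖·-homo-+ : ∀ p q p′ q′ x → ((p ℕ.+ p′) ⊖· (q ℕ.+ q′)) x ≈ (p ⊖· q) x ∙ (p′ ⊖· q′) x
    ⊖·-homo-+ p q p′ q′ x = begin
      (p ℕ.+ p′) · x ∙ ((q ℕ.+ q′) · x) ⁻¹        ≈⟨ ∙-cong (×-homo-+ x p p′) (⁻¹-cong (×-homo-+ x q q′)) ⟩
      (p · x ∙ p′ · x) ∙ (q · x ∙ q′ · x) ⁻¹      ≈⟨ ∙-congˡ (⁻¹-∙-comm _ _) ⟨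
      (p · x ∙ p′ · x) ∙ ((q · x) ⁻¹ ∙ (q′ · x) ⁻¹) ≈⟨ interchange _ _ _ _ ⟩
      (p ⊖· q) x ∙ (p′ ⊖· q′) x                   ∎

  zmul-pos : ∀ k x → zmul G (+ k) x ≈ k · x
  zmul-pos k x = reflexive (nmul≡· k x)

  zmul-homo-+ : ∀ a b x → zmul G (a ℤ.+ b) x ≈ zmul G a x ∙ zmul G b x
  zmul-homo-+ a b x with ⊖-surjective a | ⊖-surjective b
  ... | p , q , ≡.refl | p′ , q′ , ≡.refl = begin
    zmul G ((p ⊖ q) ℤ.+ (p′ ⊖ q′)) x          ≡⟨ ≡.cong (λ a → zmul G a x) (⊖-+-⊖ p q p′ q′) ⟩
    zmul G ((p ℕ.+ p′) ⊖ (q ℕ.+ q′)) x        ≈⟨ zmul-⊖ (p ℕ.+ p′) (q ℕ.+ q′) x ⟩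
    ((p ℕ.+ p′) ⊖· (q ℕ.+ q′)) x              ≈⟨ ⊖·-homo-+ p q p′ q′ x ⟩
    (p ⊖· q) x ∙ (p′ ⊖· q′) x                 ≈⟨ ∙-cong (zmul-⊖ p q x) (zmul-⊖ p′ q′ x) ⟨
    zmul G (p ⊖ q) x ∙ zmul G (p′ ⊖ q′) x     ∎

  zmul-neg : ∀ a x → zmul G (ℤ.- a) x ≈ zmul G a x ⁻¹
  zmul-neg (+ zero)  x = sym ε⁻¹≈ε
  zmul-neg (+ suc k) x = refl
  zmul-neg -[1+ k ]  x = sym (⁻¹-involutive _)

  zmul-pos-* : ∀ p b x → zmul G (+ p ℤ.* b) x ≈ p · zmul G b x
  zmul-pos-* zero    b x = refl
  zmul-pos-* (suc p) b x = begin
    zmul G (+ suc p ℤ.* b) x             ≡⟨ ≡.cong (λ a → zmul G a x) (ℤ.suc-* (+ p) b) ⟩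
    zmul G (b ℤ.+ + p ℤ.* b) x           ≈⟨ zmul-homo-+ b (+ p ℤ.* b) x ⟩
    zmul G b x ∙ zmul G (+ p ℤ.* b) x    ≈⟨ ∙-congˡ (zmul-pos-* p b x) ⟩
    zmul G b x ∙ p · zmul G b x          ∎

  zmul-assoc : ∀ a b x → zmul G (a ℤ.* b) x ≈ zmul G a (zmul G b x)
  zmul-assoc (+ p)    b x = trans (zmul-pos-* p b x) (sym (zmul-pos p _))
  zmul-assoc -[1+ p ] b x = begin
    zmul G (-[1+ p ] ℤ.* b) x        ≡⟨ ≡.cong (λ a → zmul G a x) (ℤ.neg-distribˡ-* (+ suc p) b) ⟨
    zmul G (ℤ.- (+ suc p ℤ.* b)) x   ≈⟨ zmul-neg (+ suc p ℤ.* b) x ⟩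
    zmul G (+ suc p ℤ.* b) x ⁻¹      ≈⟨ ⁻¹-cong (trans (zmul-pos-* (suc p) b x) (sym (zmul-pos (suc p) _))) ⟩
    zmul G -[1+ p ] (zmul G b x)     ∎

  zmul-distrib-∙ : ∀ a x y → zmul G a (x ∙ y) ≈ zmul G a x ∙ zmul G a y
  zmul-distrib-∙ (+ k)    x y = trans (zmul-pos k _) (trans (×-distrib-+ x y k) (sym (∙-cong (zmul-pos k x) (zmul-pos k y))))
  zmul-distrib-∙ -[1+ k ] x y = trans (⁻¹-cong (zmul-distrib-∙ (+ suc k) x y)) (sym (⁻¹-∙-comm _ _))

  zmul-ε : ∀ a → zmul G a ε ≈ ε
  zmul-ε (+ zero)   = refl
  zmul-ε (+ suc k)  = trans (zmul-pos (suc k) ε) (×-idem (identityʳ ε) (suc k))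
  zmul-ε -[1+ k ]   = trans (⁻¹-cong (zmul-ε (+ suc k))) ε⁻¹≈ε

  zmul-congʳ : ∀ a {x y} → x ≈ y → zmul G a x ≈ zmul G a y
  zmul-congʳ (+ k)    x≈y = trans (zmul-pos k _) (trans (×-congʳ k x≈y) (sym (zmul-pos k _)))
  zmul-congʳ -[1+ k ] x≈y = ⁻¹-cong (zmul-congʳ (+ suc k) x≈y)

  lsum-homo-+ : ∀ {m} (u v : Vec ℤ m) xs → lsum G (zipWith ℤ._+_ u v) xs ≈ lsum G u xs ∙ lsum G v xs
  lsum-homo-+ []      []      []       = sym (identityˡ ε)
  lsum-homo-+ (a ∷ u) (b ∷ v) (x ∷ xs) =
    trans (∙-cong (zmul-homo-+ a b x) (lsum-homo-+ u v xs)) (interchange _ _ _ _)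

  lsum-neg : ∀ {m} (u : Vec ℤ m) xs → lsum G (map ℤ.-_ u) xs ≈ lsum G u xs ⁻¹
  lsum-neg []      []       = sym ε⁻¹≈ε
  lsum-neg (a ∷ u) (x ∷ xs) = trans (∙-cong (zmul-neg a x) (lsum-neg u xs)) (⁻¹-∙-comm _ _)

  lsum-scale : ∀ {m} q (u : Vec ℤ m) xs → lsum G (map (q ℤ.*_) u) xs ≈ zmul G q (lsum G u xs)
  lsum-scale q []      []       = sym (zmul-ε q)
  lsum-scale q (a ∷ u) (x ∷ xs) =
    trans (∙-cong (zmul-assoc q a x) (lsum-scale q u xs)) (sym (zmul-distrib-∙ q _ _))

module Span {c ℓ} (G : AbelianGroup c ℓ) where
  open AbelianGroup G
  open import Algebra.Properties.AbelianGroup G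
  open import Algebra.Properties.CommutativeMonoid.Mult commutativeMonoid renaming (_×_ to _·_)
  open import Relation.Binary.Reasoning.Setoid setoid
  open Multiples G

  infix 4 _∈Span_
  _∈Span_ : ∀ {m} → Carrier → Vec Carrier m → Set ℓ
  y ∈Span xs = ∃ λ a → lsum G a xs ≈ y

  ∈Span-resp-≈ : ∀ {m} {xs : Vec Carrier m} {y z} → y ≈ z → y ∈Span xs → z ∈Span xs
  ∈Span-resp-≈ y≈z (a , eq) = a , trans eq y≈z

  ∈Span-⁻¹ : ∀ {m} {xs : Vec Carrier m} {y} → y ∈Span xs → y ⁻¹ ∈Span xs
  ∈Span-⁻¹ {xs = xs} (a , eq) = map ℤ.-_ a , trans (lsum-neg a xs) (⁻¹-cong eq)

  ∈Span-∙ : ∀ {m} {xs : Vec Carrier m} {y z} → y ∈Span xs → z ∈Span xs → y ∙ z ∈Span xs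
  ∈Span-∙ {xs = xs} (a , eqa) (b , eqb) = zipWith ℤ._+_ a b , trans (lsum-homo-+ a b xs) (∙-cong eqa eqb)

  OrderModSpan≥ : ∀ {m} → Carrier → Vec Carrier m → ℕ → Set ℓ
  OrderModSpan≥ x xs K = ∀ j → suc j < K → ¬ (suc j · x ∈Span xs)

  module _ {m} {x : Carrier} {xs : Vec Carrier m} where

    multiple∈Span⇒≡0 : ∀ {K j} → OrderModSpan≥ x xs K → j < K → j · x ∈Span xs → j ≡ 0
    multiple∈Span⇒≡0 {j = zero}  _     _   _  = ≡.refl
    multiple∈Span⇒≡0 {j = suc j} order j<K jx = ⊥-elim (order j j<K jx)

    orderModSpan-suc : ∀ {K} → OrderModSpan≥ x xs K → ¬ (K · x ∈Span xs) → OrderModSpan≥ x xs (suc K)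
    orderModSpan-suc order Kx∉ j j<1+K with ℕ.m<1+n⇒m<n∨m≡n j<1+K
    ... | inj₁ j<K    = order j j<K
    ... | inj₂ ≡.refl = Kx∉

    shift-cancel : ∀ {K y y′} j d → OrderModSpan≥ x xs K → j ℕ.+ d < K → y ∈Span xs → y′ ∈Span xs →
                   y ∙ j · x ≈ y′ ∙ (j ℕ.+ d) · x → d ≡ 0 × y ≈ y′
    shift-cancel {y = y} {y′} j d order j+d<K y∈ y′∈ eq = d≡0 , (begin
      y                ≈⟨ y≈y′∙dx ⟩
      y′ ∙ d · x       ≡⟨ ≡.cong (λ k → y′ ∙ k · x) d≡0 ⟩
      y′ ∙ ε           ≈⟨ identityʳ y′ ⟩
      y′               ∎)
      where
      y≈y′∙dx : y ≈ y′ ∙ d · x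
      y≈y′∙dx = ∙-cancelʳ (j · x) _ _ (begin
        y ∙ j · x                ≈⟨ eq ⟩
        y′ ∙ (j ℕ.+ d) · x       ≈⟨ ∙-congˡ (trans (×-homo-+ x j d) (comm _ _)) ⟩
        y′ ∙ (d · x ∙ j · x)     ≈⟨ assoc _ _ _ ⟨
        y′ ∙ d · x ∙ j · x       ∎)
      dx∈Span : d · x ∈Span xs
      dx∈Span = ∈Span-resp-≈ (trans (∙-congʳ y≈y′∙dx) (xyx⁻¹≈y y′ (d · x))) (∈Span-∙ y∈ (∈Span-⁻¹ y′∈))
      d≡0 : d ≡ 0
      d≡0 = multiple∈Span⇒≡0 order (ℕ.≤-<-trans (ℕ.m≤n+m d j) j+d<K) dx∈Span

    shift-injective : ∀ {K y y′ j j′} → OrderModSpan≥ x xs K → j < K → j′ < K → y ∈Span xs → y′ ∈Span xs →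
                      y ∙ j · x ≈ y′ ∙ j′ · x → j ≡ j′ × y ≈ y′
    shift-injective {j = j} {j′} order j<K j′<K y∈ y′∈ eq with ℕ.≤-total j j′
    ... | inj₁ j≤j′ with d , ≡.refl ← ℕ.m≤n⇒∃[o]m+o≡n j≤j′
                    with ≡.refl , y≈y′ ← shift-cancel j d order j′<K y∈ y′∈ eq
      = ≡.sym (ℕ.+-identityʳ j) , y≈y′
    ... | inj₂ j′≤j with d , ≡.refl ← ℕ.m≤n⇒∃[o]m+o≡n j′≤j
                    with ≡.refl , y′≈y ← shift-cancel j′ d order j<K y′∈ y∈ (sym eq)
      = ℕ.+-identityʳ j′ , sym y′≈y

    lsum-divMod : ∀ {e w} .{{_ : NonZero e}} → lsum G w xs ≈ e · x → ∀ a as →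
                  lsum G (a ∷ as) (x ∷ xs) ≈ (a %ℕ e) · x ∙ lsum G ((a /ℕ e) *ᵛ w +ᵛ as) xs
    lsum-divMod {e} {w} w≈ex a as = begin
      zmul G a x ∙ lsum G as xs                                   ≡⟨ ≡.cong (λ a → zmul G a x ∙ lsum G as xs) (a≡a%ℕn+[a/ℕn]*n a e) ⟩
      zmul G (+ r ℤ.+ q ℤ.* + e) x ∙ lsum G as xs                 ≈⟨ ∙-congʳ (zmul-homo-+ (+ r) (q ℤ.* + e) x) ⟩
      (zmul G (+ r) x ∙ zmul G (q ℤ.* + e) x) ∙ lsum G as xs      ≈⟨ ∙-congʳ (∙-cong (zmul-pos r x) (zmul-assoc q (+ e) x)) ⟩
      (r · x ∙ zmul G q (zmul G (+ e) x)) ∙ lsum G as xs          ≈⟨ ∙-congʳ (∙-congˡ (zmul-congʳ q (trans (zmul-pos e x) (sym w≈ex)))) ⟩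
      (r · x ∙ zmul G q (lsum G w xs)) ∙ lsum G as xs             ≈⟨ ∙-congʳ (∙-congˡ (lsum-scale q w xs)) ⟨
      (r · x ∙ lsum G (q *ᵛ w) xs) ∙ lsum G as xs                 ≈⟨ assoc _ _ _ ⟩
      r · x ∙ (lsum G (q *ᵛ w) xs ∙ lsum G as xs)                 ≈⟨ ∙-congˡ (lsum-homo-+ (q *ᵛ w) as xs) ⟨
      r · x ∙ lsum G (q *ᵛ w +ᵛ as) xs                            ∎
      where
      r : ℕ
      r = a %ℕ e
      q : ℤ
      q = a /ℕ e

    ExtendsRelationBases : Vec ℤ (suc m) → Set ℓ
    ExtendsRelationBases b = ∀ {s} {B : Vec (Vec ℤ m) s} →
      IsRelationBasis G xs B → IsRelationBasis G (x ∷ xs) (b ∷ map (+ 0 ∷_) B)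

    extendsRelationBases : ∀ {e w} .{{_ : NonZero e}} → OrderModSpan≥ x xs e → lsum G w xs ≈ e · x →
                           ExtendsRelationBases (+ e ∷ -ᵛ w)
    extendsRelationBases {e} {w} order w≈ex {s} {B} (areRelations , spans , independent) =
      areRelations′ , spans′ , independent′
      where
      b : Vec ℤ (suc m)
      b = + e ∷ -ᵛ w

      areRelations′ : ∀ j → IsRelation G (x ∷ xs) (lookup (b ∷ map (+ 0 ∷_) B) j)
      areRelations′ Fin.zero = begin
        zmul G (+ e) x ∙ lsum G (-ᵛ w) xs   ≈⟨ ∙-cong (trans (zmul-pos e x) (sym w≈ex)) (lsum-neg w xs) ⟩
        lsum G w xs ∙ lsum G w xs ⁻¹        ≈⟨ inverseʳ _ ⟩
        ε                                   ∎
      areRelations′ (Fin.suc j) rewrite Vec.lookup-map j (+ 0 ∷_) B = trans (identityˡ _) (areRelations j)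

      spans′ : ∀ a → IsRelation G (x ∷ xs) a → ∃ λ cs → comb cs (b ∷ map (+ 0 ∷_) B) ≡ a
      spans′ (a ∷ as) rel = q ∷ cs , ≡.trans (≡.cong (q *ᵛ b +ᵛ_) (comb-0∷ cs B)) (≡.cong₂ _∷_ head tail)
        where
        q : ℤ
        q = a /ℕ e
        as′ : Vec ℤ m
        as′ = q *ᵛ w +ᵛ as
        rx∙as′≈ε : (a %ℕ e) · x ∙ lsum G as′ xs ≈ ε
        rx∙as′≈ε = trans (sym (lsum-divMod {w = w} w≈ex a as)) rel
        r≡0 : a %ℕ e ≡ 0
        r≡0 = multiple∈Span⇒≡0 order (n%ℕd<d a e)
                (∈Span-resp-≈ (sym (inverseˡ-unique _ _ rx∙as′≈ε)) (∈Span-⁻¹ (as′ , refl)))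
        as′-rel : IsRelation G xs as′
        as′-rel = trans (sym (identityˡ _)) (≡.subst (λ r → r · x ∙ lsum G as′ xs ≈ ε) r≡0 rx∙as′≈ε)
        cs : Vec ℤ s
        cs = proj₁ (spans as′ as′-rel)
        head : q ℤ.* + e ℤ.+ + 0 ≡ a
        head = ≡.trans (ℤ.+-comm (q ℤ.* + e) (+ 0))
                 (≡.sym (≡.trans (a≡a%ℕn+[a/ℕn]*n a e) (≡.cong (λ r → + r ℤ.+ q ℤ.* + e) r≡0)))
        tail : q *ᵛ (-ᵛ w) +ᵛ comb cs B ≡ as
        tail = ≡.trans (≡.cong (q *ᵛ (-ᵛ w) +ᵛ_) (proj₂ (spans as′ as′-rel))) (*ᵛ-neg-cancel q w as)

      independent′ : ∀ cs → comb cs (b ∷ map (+ 0 ∷_) B) ≡ replicate (suc m) (+ 0) → cs ≡ replicate (suc s) (+ 0)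
      independent′ (c ∷ cs) comb≡0
        with head≡0 , tail≡0 ← Vec.∷-injective (≡.trans (≡.sym (≡.cong (c *ᵛ b +ᵛ_) (comb-0∷ cs B))) comb≡0)
        = ≡.cong₂ _∷_ c≡0 (independent cs (≡.trans (≡.sym (0*ᵛ-+ᵛ (-ᵛ w) (comb cs B))) tail≡0′))
        where
        c≡0 : c ≡ + 0
        c≡0 = ℤ.*-cancelʳ-≡ c (+ 0) (+ e) (≡.trans (≡.sym (ℤ.+-identityʳ _)) head≡0)
        tail≡0′ : + 0 *ᵛ (-ᵛ w) +ᵛ comb cs B ≡ replicate m (+ 0)
        tail≡0′ = ≡.subst (λ c → c *ᵛ (-ᵛ w) +ᵛ comb cs B ≡ replicate m (+ 0)) c≡0 tail≡0

  to-injective : ∀ {n} (fin : FiniteOfOrder G n) {y z} → FiniteOfOrder.to fin y ≡ FiniteOfOrder.to fin z → y ≈ z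
  to-injective fin {y} {z} eq = trans (sym (from-to y)) (trans (reflexive (≡.cong from eq)) (from-to z))
    where open FiniteOfOrder fin

  record SpanEnumeration {m N} (xs : Vec Carrier m) (V : Fin N → Carrier) (coeff : Fin N → Vec ℤ m) : Set (c ⊔ ℓ) where
    field
      value      : ∀ p → lsum G (coeff p) xs ≈ V p
      injective  : ∀ {p q} → V p ≈ V q → p ≡ q
      surjective : ∀ {y} → y ∈Span xs → ∃ λ p → y ≈ V p

    element∈Span : ∀ p → V p ∈Span xs
    element∈Span p = coeff p , value p

  SpanEnumeration-resp-≈ : ∀ {m N} {xs : Vec Carrier m} {V V′ : Fin N → Carrier} {coeff} →
                           (∀ p → V p ≈ V′ p) → SpanEnumeration xs V coeff → SpanEnumeration xs V′ coeff
  SpanEnumeration-resp-≈ V≈V′ enum = record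
    { value      = λ p → trans (value p) (V≈V′ p)
    ; injective  = λ eq → injective (trans (V≈V′ _) (trans eq (sym (V≈V′ _))))
    ; surjective = λ y∈ → let p , y≈Vp = surjective y∈ in p , trans y≈Vp (V≈V′ p)
    }
    where open SpanEnumeration enum

  module Layers {m N} (x : Carrier) {xs : Vec Carrier m} {V : Fin N → Carrier} {coeff : Fin N → Vec ℤ m}
                (enum : SpanEnumeration xs V coeff) where
    open SpanEnumeration enum

    layer : ∀ K → Fin (K * N) → Carrier
    layer K i = uncurry (λ j p → V p ∙ toℕ j · x) (remQuot {K} N i)

    layerCoeff : ∀ K → Fin (K * N) → Vec ℤ (suc m)
    layerCoeff K i = uncurry (λ j p → + toℕ j ∷ coeff p) (remQuot {K} N i)

    layer-injective : ∀ {K} → OrderModSpan≥ x xs K → ∀ {i i′} → layer K i ≈ layer K i′ → i ≡ i′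
    layer-injective {K} order {i} {i′} eq
      with j≡j′ , Vp≈Vp′ ← shift-injective order (Fin.toℕ<n (proj₁ (remQuot {K} N i)))
                                                 (Fin.toℕ<n (proj₁ (remQuot {K} N i′)))
                                                 (element∈Span _) (element∈Span _) eq
      = remQuot-injective {K} (≡.cong₂ _,_ (Fin.toℕ-injective j≡j′) (injective Vp≈Vp′))

    layers-enumerate : ∀ {e w} .{{_ : NonZero e}} → OrderModSpan≥ x xs e → lsum G w xs ≈ e · x →
                       SpanEnumeration (x ∷ xs) (layer e) (layerCoeff e)
    layers-enumerate {e} {w} order w≈ex = record
      { value      = λ i → trans (∙-cong (zmul-pos (toℕ (proj₁ (remQuot {e} N i))) x) (value _)) (comm _ _)
      ; injective  = layer-injective order
      ; surjective = layer-surjective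
      }
      where
      layer-surjective : ∀ {y} → y ∈Span (x ∷ xs) → ∃ λ i → y ≈ layer e i
      layer-surjective {y} (a ∷ as , a∷as≈y) with s , as′≈Vs ← surjective ((a /ℕ e) *ᵛ w +ᵛ as , refl) =
        combine j s , (begin
        y                                      ≈⟨ a∷as≈y ⟨
        lsum G (a ∷ as) (x ∷ xs)               ≈⟨ lsum-divMod {w = w} w≈ex a as ⟩
        (a %ℕ e) · x ∙ lsum G as′ xs           ≈⟨ ∙-congˡ as′≈Vs ⟩
        (a %ℕ e) · x ∙ V s                     ≈⟨ comm _ _ ⟩
        V s ∙ (a %ℕ e) · x                     ≡⟨ ≡.cong (λ k → V s ∙ k · x) (Fin.toℕ-fromℕ< (n%ℕd<d a e)) ⟨
        V s ∙ toℕ j · x                        ≡⟨ ≡.cong (uncurry (λ j p → V p ∙ toℕ j · x)) (Fin.remQuot-combine {e} {N} j s) ⟨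
        layer e (combine j s)                  ∎)
        where
        as′ : Vec ℤ m
        as′ = (a /ℕ e) *ᵛ w +ᵛ as
        j : Fin e
        j = Fin.fromℕ< (n%ℕd<d a e)

    OrderModSpan≥⇒*≤ : ∀ {n K} → FiniteOfOrder G n → OrderModSpan≥ x xs K → K * N ≤ n
    OrderModSpan≥⇒*≤ fin order = Fin.injective⇒≤ (λ to≡ → layer-injective order (to-injective fin to≡))

module Algorithm (I n : ℕ) where

  compareAll : ∀ {k} N → Fin k → (Fin N → Fin k) → (Fin N → Alg I k) → Alg I k → Alg I k
  compareAll zero    y v found notFound = notFound
  compareAll (suc N) y v found notFound =
    cmp y (v Fin.zero) (found Fin.zero) (compareAll N y (v ∘ Fin.suc) (found ∘ Fin.suc) notFound)

  -- Every operation pushes its result, so continuations receive a renaming of the old handles.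
  SumsCont : ℕ → ℕ → Set
  SumsCont N k = ∀ {k′} → (Fin k → Fin k′) → (Fin N → Fin k′) → Alg I k′

  addToAll : ∀ {k} N → (Fin N → Fin k) → Fin k → SumsCont N k → Alg I k
  addToAll zero    v y cont = cont id (λ ())
  addToAll (suc N) v y cont = mul (v Fin.zero) y (addToAll N (Fin.suc ∘ v ∘ Fin.suc) (Fin.suc y)
    λ ρ sums → cont (ρ ∘ Fin.suc) (ρ Fin.zero Vector.∷ sums))

  StageCont : ℕ → ℕ → Set
  StageCont m k = ∀ {k′} → (Fin k → Fin k′) →
    (N′ : ℕ) → (Fin N′ → Fin k′) → (Fin N′ → Vec ℤ (suc m)) → Vec ℤ (suc m) → Alg I k′

  module Stage {m k₀} (x : Fin k₀) (N : ℕ) (v : Fin N → Fin k₀) (coeff : Fin N → Vec ℤ m) (cont : StageCont m k₀) where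

    -- e x equals the p-th element of the span, so (e , −coeff p) is a relation
    found : ∀ {k} e → (Fin k₀ → Fin k) → (Fin e → Fin N → Fin k) → Fin N → Alg I k
    found e ρ layers p = cont ρ (e * N)
      (uncurry (λ j q → layers (Fin.opposite j) q) ∘ remQuot {e} N)
      (uncurry (λ j q → + toℕ j ∷ coeff q) ∘ remQuot {e} N)
      (+ e ∷ -ᵛ coeff p)

    -- layers j p is the handle of V p + (e ∸ 1 ∸ j) x: the newest layer is prepended at index 0
    search : ℕ → ∀ e {k} → (Fin k₀ → Fin k) → Fin k → (Fin e → Fin N → Fin k) → Alg I k
    search zero    e ρ y layers = done []
    search (suc r) e ρ y layers =
      compareAll N y (ρ ∘ v) (found e ρ layers)
        (addToAll N (ρ ∘ v) y λ σ sums →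
          mul (σ y) (σ (ρ x))
            (search r (suc e) (Fin.suc ∘ σ ∘ ρ) Fin.zero ((Fin.suc ∘ sums) Vector.∷ λ j → Fin.suc ∘ σ ∘ layers j)))

  -- A span is never empty, and n / N levels suffice because the e cosets found satisfy e · N ≤ n.
  stage : ∀ {m k} → Fin k → (N : ℕ) → (Fin N → Fin k) → (Fin N → Vec ℤ m) → StageCont m k → Alg I k
  stage x zero    v coeff cont = done []
  stage x (suc N) v coeff cont = Stage.search x (suc N) v coeff cont (n / suc N) 1 id x (λ _ → v)

  SpanCont : ℕ → ℕ → Set
  SpanCont m k = ∀ {k′} → (Fin k → Fin k′) →
    (N : ℕ) → (Fin N → Fin k′) → (Fin N → Vec ℤ m) → Vec (Vec ℤ m) m → Alg I k′

  enumerateSpan : ∀ {k} m → Vec (Fin k) m → Fin k → SpanCont m k → Alg I k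
  enumerateSpan zero    []       unit cont = cont id 1 (λ _ → unit) (λ _ → []) []
  enumerateSpan (suc m) (x ∷ xs) unit cont = enumerateSpan m xs unit λ ρ N v coeff B →
    stage (ρ x) N v coeff λ σ N′ v′ coeff′ b → cont (σ ∘ ρ) N′ v′ coeff′ (b ∷ map (+ 0 ∷_) B)

  relationBasis : Alg I (suc I)
  relationBasis = enumerateSpan I (tabulate Fin.suc) Fin.zero λ _ _ _ _ B → done B

module Semantics {c ℓ} (G : AbelianGroup c ℓ) {n} (fin : FiniteOfOrder G n) {I}
                 (Q : ∀ {s} → Vec (Vec ℤ I) s → Set ℓ) where
  open AbelianGroup G
  open import Algebra.Properties.CommutativeMonoid.Mult commutativeMonoid using (×-homo-1) renaming (_×_ to _·_)
  open Span G
  open Algorithm I n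

  record Meets (budget : ℕ) (r : Result I) : Set ℓ where
    constructor meets
    field
      correct : Q (Result.output r)
      cost≤   : Result.cost r ≤ budget

  record Achieves {k} (budget : ℕ) (t : Alg I k) (st : Vec Carrier k) : Set ℓ where
    constructor ⟨_⟩
    field
      run-meets : Meets budget (run G fin t st)

  achieves-weaken : ∀ {k B B′} {t : Alg I k} {st} → B ≤ B′ → Achieves B t st → Achieves B′ t st
  achieves-weaken B≤B′ ⟨ meets q cost≤B ⟩ = ⟨ meets q (ℕ.≤-trans cost≤B B≤B′) ⟩

  private
    meets-mul : ∀ {k B a b} {t : Alg I (suc k)} {st} →
                Meets B (run G fin t ((lookup st a ∙ lookup st b) ∷ st)) → Meets (suc B) (run G fin (mul a b t) st)
    meets-mul {a = a} {b} {t} {st} (meets q cost≤) with run G fin t ((lookup st a ∙ lookup st b) ∷ st)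
    ... | result _ _ = meets q (s≤s cost≤)

  achieves-mul : ∀ {k B a b} {t : Alg I (suc k)} {st} →
                 Achieves B t ((lookup st a ∙ lookup st b) ∷ st) → Achieves (suc B) (mul a b t) st
  achieves-mul {a = a} {b} {t} {st} ⟨ h ⟩ = ⟨ meets-mul {a = a} {b} {t} {st} h ⟩

  private
    meets-cmp : ∀ {k B a b} {t u : Alg I k} {st} →
                (lookup st a ≈ lookup st b → Achieves B t st) → (¬ lookup st a ≈ lookup st b → Achieves B u st) →
                Meets (suc B) (run G fin (cmp a b t u) st)
    meets-cmp {a = a} {b} {t} {u} {st} ht hu with decEq G fin (lookup st a) (lookup st b)
    ... | yes eq with run G fin t st | Achieves.run-meets (ht eq)
    ...   | result _ _ | meets q cost≤ = meets q (s≤s cost≤)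
    meets-cmp {a = a} {b} {t} {u} {st} ht hu | no ¬eq with run G fin u st | Achieves.run-meets (hu ¬eq)
    ...   | result _ _ | meets q cost≤ = meets q (s≤s cost≤)

  achieves-cmp : ∀ {k B a b} {t u : Alg I k} {st} →
                 (lookup st a ≈ lookup st b → Achieves B t st) → (¬ lookup st a ≈ lookup st b → Achieves B u st) →
                 Achieves (suc B) (cmp a b t u) st
  achieves-cmp ht hu = ⟨ meets-cmp ht hu ⟩

  compareAll-achieves : ∀ {k B} N y v {found : Fin N → Alg I k} {notFound} {st : Vec Carrier k} →
    (∀ p → lookup st y ≈ lookup st (v p) → Achieves B (found p) st) →
    ((∀ p → ¬ lookup st y ≈ lookup st (v p)) → Achieves B notFound st) →
    Achieves (N ℕ.+ B) (compareAll N y v found notFound) st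
  compareAll-achieves zero    y v hf hn = hn (λ ())
  compareAll-achieves {B = B} (suc N) y v hf hn = achieves-cmp
    (λ eq → achieves-weaken (ℕ.m≤n+m B N) (hf Fin.zero eq))
    (λ ¬eq → compareAll-achieves N y (v ∘ Fin.suc) (hf ∘ Fin.suc) λ ¬eqs → hn λ where
      Fin.zero    → ¬eq
      (Fin.suc p) → ¬eqs p)

  Embeds : ∀ {k k′} → (Fin k → Fin k′) → Vec Carrier k → Vec Carrier k′ → Set c
  Embeds ρ st st′ = ∀ i → lookup st′ (ρ i) ≡ lookup st i

  addToAll-achieves : ∀ {k B} N v y {cont : SumsCont N k} {st : Vec Carrier k} →
    (∀ {k′} (ρ : Fin k → Fin k′) sums st′ → Embeds ρ st st′ →
       (∀ p → lookup st′ (sums p) ≈ lookup st (v p) ∙ lookup st y) → Achieves B (cont ρ sums) st′) →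
    Achieves (N ℕ.+ B) (addToAll N v y cont) st
  addToAll-achieves zero    v y {st = st} h = h id (λ ()) st (λ _ → ≡.refl) (λ ())
  addToAll-achieves (suc N) v y {st = st} h = achieves-mul (addToAll-achieves N (Fin.suc ∘ v ∘ Fin.suc) (Fin.suc y)
    {st = (lookup st (v Fin.zero) ∙ lookup st y) ∷ st}
    λ ρ sums st′ embeds sums≈ → h (ρ ∘ Fin.suc) (ρ Fin.zero Vector.∷ sums) st′ (embeds ∘ Fin.suc) λ where
      Fin.zero    → reflexive (embeds Fin.zero)
      (Fin.suc p) → sums≈ p)

  StageContAchieves : ∀ {m k} → ℕ → StageCont m k → Vec Carrier k → Carrier → Vec Carrier m → Set (c ⊔ ℓ)
  StageContAchieves D cont st x xs = ∀ {k′} ρ (st′ : Vec Carrier k′) → Embeds ρ st st′ → ∀ N′ v′ coeff′ b →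
    SpanEnumeration (x ∷ xs) (lookup st′ ∘ v′) coeff′ → ExtendsRelationBases {x = x} {xs} b →
    Achieves D (cont ρ N′ v′ coeff′ b) st′

  module StageAchieves {m k₀} (x : Fin k₀) (N : ℕ) .{{_ : NonZero N}} (v : Fin N → Fin k₀) (coeff : Fin N → Vec ℤ m)
                       (cont : StageCont m k₀) (st₀ : Vec Carrier k₀) {xs : Vec Carrier m}
                       (enum : SpanEnumeration xs (lookup st₀ ∘ v) coeff)
                       {D : ℕ} (cont-achieves : StageContAchieves D cont st₀ (lookup st₀ x) xs) where
    open Stage x N v coeff cont
    open SpanEnumeration enum
    open Layers (lookup st₀ x) enum

    X : Carrier
    X = lookup st₀ x

    V : Fin N → Carrier
    V = lookup st₀ ∘ v

    record Invariant e {k} (ρ : Fin k₀ → Fin k) (y : Fin k) (layers : Fin e → Fin N → Fin k)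
                     (st : Vec Carrier k) : Set (c ⊔ ℓ) where
      field
        embeds  : Embeds ρ st₀ st
        y≈eX    : lookup st y ≈ e · X
        layers≈ : ∀ j p → lookup st (layers j p) ≈ V p ∙ toℕ (Fin.opposite j) · X
        order   : OrderModSpan≥ X xs e

    found-achieves : ∀ {e} .{{_ : NonZero e}} {k ρ y layers} {st : Vec Carrier k} → Invariant e ρ y layers st →
                     ∀ p → e · X ≈ V p → Achieves D (found e ρ layers p) st
    found-achieves {e} {ρ = ρ} {layers = layers} {st} holds p eX≈Vp =
      cont-achieves ρ st embeds (e * N) _ _ _
        (SpanEnumeration-resp-≈ layer≈ (layers-enumerate {w = coeff p} order w≈eX))
        (extendsRelationBases {w = coeff p} order w≈eX)
      where
      open Invariant holds
      w≈eX : lsum G (coeff p) xs ≈ e · X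
      w≈eX = trans (value p) (sym eX≈Vp)
      layer≈ : ∀ i → layer e i ≈ lookup st (uncurry (λ j q → layers (Fin.opposite j) q) (remQuot {e} N i))
      layer≈ i = sym (trans (layers≈ (Fin.opposite j) q)
                            (reflexive (≡.cong (λ j → V q ∙ toℕ j · X) (Fin.opposite-involutive j))))
        where
        j : Fin e
        j = proj₁ (remQuot {e} N i)
        q : Fin N
        q = proj₂ (remQuot {e} N i)

    invariant-next : ∀ {e k ρ y layers} {st : Vec Carrier k} → Invariant e ρ y layers st → ¬ (e · X ∈Span xs) →
      ∀ {k′} {σ : Fin k → Fin k′} {sums st′} → Embeds σ st st′ →
      (∀ p → lookup st′ (sums p) ≈ lookup st (ρ (v p)) ∙ lookup st y) →
      Invariant (suc e) (Fin.suc ∘ σ ∘ ρ) Fin.zero ((Fin.suc ∘ sums) Vector.∷ λ j → Fin.suc ∘ σ ∘ layers j)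
                ((lookup st′ (σ y) ∙ lookup st′ (σ (ρ x))) ∷ st′)
    invariant-next {e} {ρ = ρ} {y} {layers} holds eX∉Span {σ = σ} {sums} {st′} σ-embeds sums≈ = record
      { embeds  = λ i → ≡.trans (σ-embeds (ρ i)) (embeds i)
      ; y≈eX    = trans (∙-cong (trans (reflexive (σ-embeds y)) y≈eX) (reflexive (≡.trans (σ-embeds (ρ x)) (embeds x))))
                        (comm _ _)
      ; layers≈ = λ where
          Fin.zero    p → trans (sums≈ p) (∙-cong (reflexive (embeds (v p)))
                                  (trans y≈eX (reflexive (≡.cong (_· X) (≡.sym (Fin.toℕ-fromℕ e))))))
          (Fin.suc j) p → trans (reflexive (σ-embeds (layers j p)))
                            (trans (layers≈ j p) (reflexive (≡.cong (λ k → V p ∙ k · X) (≡.sym (Fin.opposite-suc j)))))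
      ; order   = orderModSpan-suc order eX∉Span
      }
      where open Invariant holds

    levelCost : ℕ
    levelCost = suc (2 * N)

    search-achieves : ∀ r e .{{_ : NonZero e}} {k ρ y layers} {st : Vec Carrier k} → Invariant e ρ y layers st →
      e ℕ.+ r ≡ suc (n / N) → Achieves (D ℕ.+ r * levelCost) (search r e ρ y layers) st
    search-achieves zero e holds e+0≡ =
      ⊥-elim ([1+m/n]*n≰m n N (≡.subst (λ e → e * N ≤ n) (≡.trans (≡.sym (ℕ.+-identityʳ e)) e+0≡)
                                        (OrderModSpan≥⇒*≤ fin (Invariant.order holds))))
    search-achieves (suc r) e {ρ = ρ} {y} {st = st} holds e+r≡ =
      achieves-weaken (ℕ.≤-reflexive (budget N D (r * levelCost)))
        (compareAll-achieves N y (ρ ∘ v)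
          (λ p y≈Vp → achieves-weaken (ℕ.≤-trans (ℕ.m≤m+n D _) (ℕ.≤-trans (ℕ.n≤1+n _) (ℕ.m≤n+m _ N)))
                        (found-achieves holds p (trans (sym y≈eX) (trans y≈Vp (reflexive (embeds (v p)))))))
          λ notFound → addToAll-achieves N (ρ ∘ v) y λ σ sums st′ σ-embeds sums≈ →
            achieves-mul (search-achieves r (suc e) (invariant-next holds (eX∉Span notFound) σ-embeds sums≈)
                                          (≡.trans (≡.sym (ℕ.+-suc e r)) e+r≡)))
      where
      open Invariant holds
      budget : ∀ N D R → N ℕ.+ (N ℕ.+ suc (D ℕ.+ R)) ≡ D ℕ.+ (suc (2 * N) ℕ.+ R)
      budget = ℕ-solve-∀
      eX∉Span : (∀ p → ¬ lookup st y ≈ lookup st (ρ (v p))) → ¬ (e · X ∈Span xs)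
      eX∉Span notFound eX∈ with p , eX≈Vp ← surjective eX∈ =
        notFound p (trans y≈eX (trans eX≈Vp (sym (reflexive (embeds (v p))))))

  stage-achieves : ∀ {m k} x N v coeff (cont : StageCont m k) (st : Vec Carrier k) {xs : Vec Carrier m} {D} →
    SpanEnumeration xs (lookup st ∘ v) coeff → StageContAchieves D cont st (lookup st x) xs →
    Achieves (D ℕ.+ 3 * n) (stage x N v coeff cont) st
  stage-achieves x zero v coeff cont st {xs} enum _ with () ← proj₁ (SpanEnumeration.surjective enum (replicate _ (+ 0) , refl))
  stage-achieves x (suc N) v coeff cont st {D = D} enum cont-achieves =
    achieves-weaken (ℕ.+-monoʳ-≤ D (m/n*[1+2n]≤3m n (suc N)))
      (search-achieves (n / suc N) 1 {ρ = id} {x} {λ _ → v} {st} initial ≡.refl)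
    where
    open StageAchieves x (suc N) v coeff cont st enum cont-achieves
    initial : Invariant 1 id x (λ _ → v) st
    initial = record
      { embeds  = λ _ → ≡.refl
      ; y≈eX    = sym (×-homo-1 _)
      ; layers≈ = λ { Fin.zero p → sym (identityʳ _) }
      ; order   = λ { _ (s≤s ()) }
      }

  SpanContAchieves : ∀ {m k} → ℕ → SpanCont m k → Vec Carrier k → Vec Carrier m → Set (c ⊔ ℓ)
  SpanContAchieves D cont st xs = ∀ {k′} ρ (st′ : Vec Carrier k′) → Embeds ρ st st′ → ∀ N v coeff B →
    SpanEnumeration xs (lookup st′ ∘ v) coeff → IsRelationBasis G xs B → Achieves D (cont ρ N v coeff B) st′

  enumerateSpan-achieves : ∀ {m k} (hs : Vec (Fin k) m) unit (cont : SpanCont m k) (st : Vec Carrier k) {xs} {D} →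
    Embeds (lookup hs) xs st → lookup st unit ≈ ε → SpanContAchieves D cont st xs →
    Achieves (D ℕ.+ m * (3 * n)) (enumerateSpan m hs unit cont) st
  enumerateSpan-achieves [] unit cont st {[]} {D} _ unit≈ε cont-achieves =
    achieves-weaken (ℕ.m≤m+n D 0) (cont-achieves id st (λ _ → ≡.refl) 1 _ _ [] trivial emptyBasis)
    where
    trivial : SpanEnumeration [] (λ _ → lookup st unit) (λ _ → [])
    trivial = record
      { value      = λ _ → sym unit≈ε
      ; injective  = λ { {Fin.zero} {Fin.zero} _ → ≡.refl ; {Fin.suc ()} ; {q = Fin.suc ()} }
      ; surjective = λ { ([] , ε≈y) → Fin.zero , trans (sym ε≈y) (sym unit≈ε) }
      }
    emptyBasis : IsRelationBasis G [] []
    emptyBasis = (λ ()) , (λ { [] _ → [] , ≡.refl }) , λ { [] _ → ≡.refl }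
  enumerateSpan-achieves {suc m} (h ∷ hs) unit cont st {X ∷ xs} {D} embeds unit≈ε cont-achieves =
    achieves-weaken (ℕ.≤-reflexive (ℕ.+-assoc D (3 * n) (m * (3 * n))))
      (enumerateSpan-achieves hs unit _ st (embeds ∘ Fin.suc) unit≈ε
        λ ρ st′ ρ-embeds N v coeff B enum basis →
          stage-achieves (ρ h) N v coeff _ st′ enum
            (≡.subst (λ Y → StageContAchieves D _ st′ Y xs) (≡.sym (≡.trans (ρ-embeds h) (embeds Fin.zero)))
              λ σ st″ σ-embeds N′ v′ coeff′ b enum′ extends →
                cont-achieves (σ ∘ ρ) st″ (λ i → ≡.trans (σ-embeds (ρ i)) (ρ-embeds i))
                              N′ v′ coeff′ _ enum′ (extends basis)))

lemma17 : ∀ {c ℓ} →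
    Σ ((I n : ℕ) → Alg I (suc I)) λ alg →
      ∀ (G : AbelianGroup c ℓ) (n : ℕ) (fin : FiniteOfOrder G n)
        (I : ℕ) (xs : Vec (AbelianGroup.Carrier G) I) →
        IsRelationBasis G xs (Result.output (run G fin (alg I n) (AbelianGroup.ε G ∷ xs)))
        × Result.cost (run G fin (alg I n) (AbelianGroup.ε G ∷ xs)) ≤ 3 * I * n
lemma17 = Algorithm.relationBasis , λ G n fin I xs →
  let open Semantics G fin (IsRelationBasis G xs)
      ⟨ meets isBasis cost≤ ⟩ = enumerateSpan-achieves (tabulate Fin.suc) Fin.zero (λ _ _ _ _ B → done B)
                                  (AbelianGroup.ε G ∷ xs)
                                  (λ i → ≡.cong (lookup (AbelianGroup.ε G ∷ xs)) (Vec.lookup∘tabulate Fin.suc i))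
                                  (AbelianGroup.refl G)
                                  (λ _ _ _ _ _ _ B _ isBasis → ⟨ meets isBasis z≤n ⟩)
  in isBasis , ℕ.≤-trans cost≤ (ℕ.≤-reflexive (I*[3*n]≡3*I*n I n))
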